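{- Let $G_n^{[1]}$ be the induced subgraph of $G_n$ on the set of partitions $\lambda\vdash n$ with $\sigma(\lambda)=1$. Then $G_2^{[1]}$ consists of the single edge $(2)\sim(1,1)$, and $G_n^{[1]}$ is edgeless for all $n\ge3$.
   Context: $G_n$ is the partition graph: its vertices are the partitions of $n$, and two distinct partitions $\lambda\neq\mu$ are adjacent when $\mu$ is obtained from $\lambda$ by moving one cell from one part (of size $x$, the part shrinking to $x-1$ and disappearing if $x=1$) to another part or to a new part of size $1$, followed by reordering the parts in weakly decreasing order. $\sigma(\lambda)$ is the number of distinct part sizes of $\lambda$. -}

module Defs where

open import Data.Nat using (ℕ; zero; suc; _≤_; _≥_; _<_; pred)
open import Data.Nat.ListAction using (sum)
open import Data.List using (List; []; _∷_; deduplicate; length; filter; _++_; [_])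
open import Data.List.Relation.Unary.All using (All)
open import Data.List.Relation.Unary.Linked using (Linked)
open import Data.List.Relation.Binary.Permutation.Propositional using (_↭_)
open import Data.Product using (Σ; ∃; _×_; _,_)
open import Data.Sum using (_⊎_)
open import Relation.Nullary using (¬_; ¬?; yes; no)
open import Relation.Binary.PropositionalEquality using (_≡_)
open import Data.Nat.Properties using (_≟_)

IsPartition : ℕ → List ℕ → Set
IsPartition n p = All (λ x → 1 ≤ x) p × Linked _≥_ p × sum p ≡ n

modifyAt : ℕ → (ℕ → ℕ) → List ℕ → List ℕ
modifyAt _       f []       = []
modifyAt zero    f (x ∷ xs) = f x ∷ xs
modifyAt (suc i) f (x ∷ xs) = x ∷ modifyAt i f xs

-- discard parts equal to 0 (a part of size 1 that lost its cell disappears)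
dropZeros : List ℕ → List ℕ
dropZeros = filter (λ x → ¬? (x ≟ 0))

moveTo : ℕ → ℕ → List ℕ → List ℕ
moveTo i j p = dropZeros (modifyAt j suc (modifyAt i pred p))

moveNew : ℕ → List ℕ → List ℕ
moveNew i p = dropZeros (modifyAt i pred p ++ [ 1 ])

-- μ is obtained from λ by one cell move followed by reordering
-- (μ is a rearrangement, i.e. permutation, of the raw result).
OneMove : List ℕ → List ℕ → Set
OneMove λ' μ =
  Σ ℕ λ i → i < length λ' ×
    ((Σ ℕ λ j → j < length λ' × ¬ (i ≡ j) × (μ ↭ moveTo i j λ'))
     ⊎ (μ ↭ moveNew i λ'))

Adjacent : List ℕ → List ℕ → Set
Adjacent λ' μ = ¬ (λ' ≡ μ) × OneMove λ' μ

σ : List ℕ → ℕ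
σ p = length (deduplicate _≟_ p)

InG1 : ℕ → List ℕ → Set
InG1 n p = IsPartition n p × σ p ≡ 1

{-# OPTIONS --safe #-}
module Submission where

open import Defs
open import Data.Nat using (ℕ; _≥_; zero; suc; _+_; _*_; _≤_; _<_; z≤n; s≤s; pred)
open import Data.Nat.Properties using (_≟_; ≤-trans; *-identityʳ; *-cancelʳ-<; m≢1+m+n; m≢1+n+m)
open import Data.Nat.ListAction using (sum)
open import Data.List using (List; []; _∷_; length; deduplicate)
open import Data.List.Relation.Unary.All as All using (All; []; _∷_)
open import Data.List.Relation.Unary.Any using (here; there)
open import Data.List.Relation.Unary.Linked using ([-]; _∷_)
open import Data.List.Membership.Propositional using (_∈_)
open import Data.List.Membership.Propositional.Properties
  using (∈-deduplicate⁺; ∈-filter⁺; ∈-++⁺ˡ; ∈-++⁺ʳ)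
open import Data.List.Relation.Binary.Permutation.Propositional using (_↭_; ↭-sym; ↭-refl)
open import Data.List.Relation.Binary.Permutation.Propositional.Properties using (∈-resp-↭)
open import Data.Product using (_×_; _,_; proj₁; ∃-syntax)
open import Data.Sum using (_⊎_; inj₁; inj₂)
open import Data.Empty using (⊥-elim)
open import Function using (_∘_)
open import Relation.Binary.PropositionalEquality using (_≡_; _≢_; refl; sym; trans; cong; subst)
open import Relation.Nullary using (¬_; ¬?)

-- All parts of a partition with σ = 1 equal some a. Moving a cell between two
-- parts creates the part a + 1 next to a − 1, or, when a = 1, next to a third
-- part 1, which exists because n ≥ 3. Moving a cell to a new part creates the
-- part 1 next to a − 1, or, when a = 2, next to a second part 2. Either way the
-- result has two distinct part sizes, except for moving a cell of (1, …, 1) to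
-- a new part, which returns the same partition.

private
  variable
    a i j k v : ℕ
    xs ys : List ℕ

AllEqual : List ℕ → Set
AllEqual xs = ∀ {x y} → x ∈ xs → y ∈ xs → x ≡ y

σ≡1⇒AllEqual : σ xs ≡ 1 → AllEqual xs
σ≡1⇒AllEqual {xs} _ x∈ y∈
  with deduplicate _≟_ xs | ∈-deduplicate⁺ _≟_ x∈ | ∈-deduplicate⁺ _≟_ y∈
... | _ ∷ [] | here x≡c | here y≡c = trans x≡c (sym y≡c)

AllEqual-resp-↭ : xs ↭ ys → AllEqual xs → AllEqual ys
AllEqual-resp-↭ xs↭ys eq x∈ y∈ = eq (∈-resp-↭ (↭-sym xs↭ys) x∈) (∈-resp-↭ (↭-sym xs↭ys) y∈)

AllEqual⇒All≡ : AllEqual xs → a ∈ xs → All (_≡ a) xs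
AllEqual⇒All≡ eq a∈ = All.tabulate (λ x∈ → eq x∈ a∈)

sum-All≡ : All (_≡ a) xs → sum xs ≡ length xs * a
sum-All≡ []            = refl
sum-All≡ (refl ∷ xs≡a) = cong (_ +_) (sum-All≡ xs≡a)

All≡1-sum-injective : All (_≡ 1) xs → All (_≡ 1) ys → sum xs ≡ sum ys → xs ≡ ys
All≡1-sum-injective []             []             _  = refl
All≡1-sum-injective []             (refl ∷ _)     ()
All≡1-sum-injective (refl ∷ _)     []             ()
All≡1-sum-injective (refl ∷ xs≡1) (refl ∷ ys≡1) Σ≡ =
  cong (1 ∷_) (All≡1-sum-injective xs≡1 ys≡1 (cong pred Σ≡))

infix 4 _[_]=_

data _[_]=_ : List ℕ → ℕ → ℕ → Set where
  here  : (v ∷ xs) [ 0 ]= v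
  there : ∀ {x} → xs [ k ]= v → (x ∷ xs) [ suc k ]= v

[]=⇒∈ : xs [ k ]= v → v ∈ xs
[]=⇒∈ here          = here refl
[]=⇒∈ (there xs[k]) = there ([]=⇒∈ xs[k])

All≡⇒[]= : All (_≡ a) xs → k < length xs → xs [ k ]= a
All≡⇒[]= {k = zero}  (refl ∷ _)  _        = here
All≡⇒[]= {k = suc k} (_ ∷ xs≡a) (s≤s k<) = there (All≡⇒[]= xs≡a k<)

modifyAt-[]= : ∀ f → xs [ k ]= v → modifyAt k f xs [ k ]= f v
modifyAt-[]= f here          = here
modifyAt-[]= f (there xs[k]) = there (modifyAt-[]= f xs[k])

modifyAt-[]=-≢ : ∀ f → k ≢ i → xs [ k ]= v → modifyAt i f xs [ k ]= v
modifyAt-[]=-≢ {i = zero}  f k≢i here          = ⊥-elim (k≢i refl)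
modifyAt-[]=-≢ {i = suc i} f k≢i here          = here
modifyAt-[]=-≢ {i = zero}  f k≢i (there xs[k]) = there xs[k]
modifyAt-[]=-≢ {i = suc i} f k≢i (there xs[k]) = there (modifyAt-[]=-≢ f (k≢i ∘ cong suc) xs[k])

∈-dropZeros : v ≢ 0 → v ∈ xs → v ∈ dropZeros xs
∈-dropZeros v≢0 v∈ = ∈-filter⁺ (λ x → ¬? (x ≟ 0)) v∈ v≢0

1∈moveNew : ∀ i xs → 1 ∈ moveNew i xs
1∈moveNew i xs = ∈-dropZeros (λ ()) (∈-++⁺ʳ (modifyAt i pred xs) (here refl))

avoid₁ : ∀ i → ∃[ l ] l < 2 × l ≢ i
avoid₁ zero    = 1 , s≤s (s≤s z≤n) , λ ()
avoid₁ (suc _) = 0 , s≤s z≤n , λ ()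

avoid₂ : ∀ i j → ∃[ l ] l < 3 × l ≢ i × l ≢ j
avoid₂ zero          zero          = 1 , s≤s (s≤s z≤n) , (λ ()) , (λ ())
avoid₂ zero          (suc zero)    = 2 , s≤s (s≤s (s≤s z≤n)) , (λ ()) , (λ ())
avoid₂ zero          (suc (suc _)) = 1 , s≤s (s≤s z≤n) , (λ ()) , (λ ())
avoid₂ (suc zero)    zero          = 2 , s≤s (s≤s (s≤s z≤n)) , (λ ()) , (λ ())
avoid₂ (suc (suc _)) zero          = 1 , s≤s (s≤s z≤n) , (λ ()) , (λ ())
avoid₂ (suc _)       (suc _)       = 0 , s≤s z≤n , (λ ()) , (λ ())

moveTo-¬AllEqual : All (_≡ a) xs → 1 ≤ a → 3 ≤ sum xs →
                   i < length xs → j < length xs → i ≢ j → ¬ AllEqual (moveTo i j xs)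
moveTo-¬AllEqual {a = suc zero} {xs} {i} {j} xs≡1 _ 3≤Σ i< j< i≢j eq
  with avoid₂ i j
... | l , l<3 , l≢i , l≢j = m≢1+m+n 1 (eq kept raised)
  where
  3≤length : 3 ≤ length xs
  3≤length = subst (3 ≤_) (trans (sum-All≡ xs≡1) (*-identityʳ _)) 3≤Σ
  kept : 1 ∈ moveTo i j xs
  kept = ∈-dropZeros (λ ())
    ([]=⇒∈ (modifyAt-[]=-≢ suc l≢j (modifyAt-[]=-≢ pred l≢i (All≡⇒[]= xs≡1 (≤-trans l<3 3≤length)))))
  raised : 2 ∈ moveTo i j xs
  raised = ∈-dropZeros (λ ())
    ([]=⇒∈ (modifyAt-[]= suc (modifyAt-[]=-≢ pred (i≢j ∘ sym) (All≡⇒[]= xs≡1 j<))))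
moveTo-¬AllEqual {a = suc (suc b)} {xs} {i} {j} xs≡a _ _ i< j< i≢j eq =
  m≢1+n+m (suc b) {1} (eq lowered raised)
  where
  lowered : suc b ∈ moveTo i j xs
  lowered = ∈-dropZeros (λ ())
    ([]=⇒∈ (modifyAt-[]=-≢ suc i≢j (modifyAt-[]= pred (All≡⇒[]= xs≡a i<))))
  raised : suc (suc (suc b)) ∈ moveTo i j xs
  raised = ∈-dropZeros (λ ())
    ([]=⇒∈ (modifyAt-[]= suc (modifyAt-[]=-≢ pred (i≢j ∘ sym) (All≡⇒[]= xs≡a j<))))

moveNew-¬AllEqual : All (_≡ a) xs → 2 ≤ a → 3 ≤ sum xs → i < length xs → ¬ AllEqual (moveNew i xs)
moveNew-¬AllEqual {a = 1} _ (s≤s ()) _ _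
moveNew-¬AllEqual {a = 2} {xs} {i} xs≡2 _ 3≤Σ _ eq with avoid₁ i
... | l , l<2 , l≢i = m≢1+m+n 1 (eq (1∈moveNew i xs) kept)
  where
  2≤length : 2 ≤ length xs
  2≤length = *-cancelʳ-< 2 1 (length xs) (subst (3 ≤_) (sum-All≡ xs≡2) 3≤Σ)
  kept : 2 ∈ moveNew i xs
  kept = ∈-dropZeros (λ ())
    (∈-++⁺ˡ ([]=⇒∈ (modifyAt-[]=-≢ pred l≢i (All≡⇒[]= xs≡2 (≤-trans l<2 2≤length)))))
moveNew-¬AllEqual {a = suc (suc (suc b))} {xs} {i} xs≡a _ _ i< eq =
  m≢1+m+n 1 (eq (1∈moveNew i xs) lowered)
  where
  lowered : suc (suc b) ∈ moveNew i xs
  lowered = ∈-dropZeros (λ ()) (∈-++⁺ˡ ([]=⇒∈ (modifyAt-[]= pred (All≡⇒[]= xs≡a i<))))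

OneMove-between-AllEqual⇒ones : All (_≡ a) xs → 1 ≤ a → 3 ≤ sum xs → OneMove xs ys → AllEqual ys →
                                All (_≡ 1) xs × All (_≡ 1) ys
OneMove-between-AllEqual⇒ones xs≡a 1≤a 3≤Σ (i , i< , inj₁ (j , j< , i≢j , ys↭)) eq =
  ⊥-elim (moveTo-¬AllEqual xs≡a 1≤a 3≤Σ i< j< i≢j (AllEqual-resp-↭ ys↭ eq))
OneMove-between-AllEqual⇒ones {a = 1} {xs} xs≡1 _ _ (i , _ , inj₂ ys↭) eq =
  xs≡1 , AllEqual⇒All≡ eq (∈-resp-↭ (↭-sym ys↭) (1∈moveNew i xs))
OneMove-between-AllEqual⇒ones {a = suc (suc _)} xs≡a _ 3≤Σ (i , i< , inj₂ ys↭) eq =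
  ⊥-elim (moveNew-¬AllEqual xs≡a (s≤s (s≤s z≤n)) 3≤Σ i< (AllEqual-resp-↭ ys↭ eq))

G1-edgeless : ∀ n → n ≥ 3 → ∀ p q → InG1 n p → InG1 n q → ¬ Adjacent p q
G1-edgeless _ _ [] _ (_ , ()) _ _
G1-edgeless _ n≥3 (a ∷ _) q ((1≤a ∷ _ , _ , Σp≡n) , σp≡1) ((_ , _ , Σq≡n) , σq≡1) (p≢q , move)
  with OneMove-between-AllEqual⇒ones (AllEqual⇒All≡ (σ≡1⇒AllEqual σp≡1) (here refl)) 1≤a
         (subst (3 ≤_) (sym Σp≡n) n≥3) move (σ≡1⇒AllEqual σq≡1)
... | p≡1 , q≡1 = p≢q (All≡1-sum-injective p≡1 q≡1 (trans Σp≡n (sym Σq≡n)))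

partitions-of-2 : ∀ p → IsPartition 2 p → p ≡ 2 ∷ [] ⊎ p ≡ 1 ∷ 1 ∷ []
partitions-of-2 (2 ∷ [])     _ = inj₁ refl
partitions-of-2 (1 ∷ 1 ∷ []) _ = inj₂ refl
partitions-of-2 [] (_ , _ , ())
partitions-of-2 (0 ∷ _) (() ∷ _ , _)
partitions-of-2 (1 ∷ []) (_ , _ , ())
partitions-of-2 (1 ∷ 0 ∷ _) (_ ∷ () ∷ _ , _)
partitions-of-2 (1 ∷ 1 ∷ 0 ∷ _) (_ ∷ _ ∷ () ∷ _ , _)
partitions-of-2 (1 ∷ 1 ∷ suc _ ∷ _) (_ , _ , ())
partitions-of-2 (1 ∷ suc (suc _) ∷ _) (_ , _ , ())
partitions-of-2 (2 ∷ 0 ∷ _) (_ ∷ () ∷ _ , _)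
partitions-of-2 (2 ∷ suc _ ∷ _) (_ , _ , ())
partitions-of-2 (suc (suc (suc _)) ∷ _) (_ , _ , ())

proposition6p3 : (InG1 2 (2 ∷ []) × InG1 2 (1 ∷ 1 ∷ []) × Adjacent (2 ∷ []) (1 ∷ 1 ∷ [])
    × (∀ p → InG1 2 p → p ≡ 2 ∷ [] ⊎ p ≡ 1 ∷ 1 ∷ []))
    × (∀ n → n ≥ 3 → ∀ p q → InG1 n p → InG1 n q → ¬ Adjacent p q)
proposition6p3 =
  ( ((s≤s z≤n ∷ [] , [-] , refl) , refl)
  , ((s≤s z≤n ∷ s≤s z≤n ∷ [] , s≤s z≤n ∷ [-] , refl) , refl)
  , ((λ ()) , 0 , s≤s z≤n , inj₂ ↭-refl)
  , λ p → partitions-of-2 p ∘ proj₁ )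
  , G1-edgeless
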